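{- The tree $T$ generated by a test is a tree on $2\times 2$ with acyclic levels.
   Context: Let $\varphi:\omega\to\omega^2$ be the bijection with inverse $\langle n,p\rangle:=\varphi^{ -1}(n,p)=\left(\sum_{k\le n+p}k\right)+p$, and write $\varphi(q)=((q)_0,(q)_1)$. A set $E\subseteq\bigcup_{q\in\omega}2^q\times 2^q$ is a test if: (a) for every $q\in\omega$ there is a unique $(s_q,t_q)\in E\cap(2^q\times 2^q)$; (b) for all $m,p\in\omega$ and $u\in 2^{<\omega}$ there is $v\in 2^{<\omega}$ with $(s_p0uv,t_p1uv)\in E$ and $(|t_p1uv|-1)_0=m$; (c) for every $n>0$ there are $q<n$ and $w\in 2^{<\omega}$ with $s_n=s_q0w$ and $t_n=t_q1w$ (juxtaposition denotes concatenation). The tree generated by $E$ is $T:=\{(s,t)\in 2^{<\omega}\times 2^{<\omega}: s=t=\emptyset\text{ or }\exists q\in\omega\ \exists w\in 2^{<\omega}\ (s,t)=(s_q0w,t_q1w)\}$. A tree on $2\times 2$ (a set of pairs of equal-length binary sequences closed under restriction) has acyclic levels if for every $p$ the bipartite graph with vertex set $(2^p\times\{0\})\cup(2^p\times\{1\})$ and edges $\{(s,0),(t,1)\}$ for $(s,t)\in T\cap(2^p\times 2^p)$ is acyclic. -}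

module Defs where

open import Data.Nat using (ℕ; zero; suc; _+_; _∸_; _<_; _≤_)
open import Data.Bool using (Bool; true; false)
open import Data.List using (List; []; _∷_; _++_; length; take)
open import Data.List.Relation.Unary.Unique.Propositional using (Unique)
open import Data.List.Relation.Unary.All using (All)
open import Data.List.Relation.Unary.Linked using (Linked)
open import Data.List using (head; last)
open import Data.Maybe using (Maybe; just; nothing)
open import Data.Product using (Σ; ∃; _×_; _,_; proj₁; proj₂)
open import Data.Sum using (_⊎_)
open import Data.Empty using (⊥)
open import Data.Unit using (⊤)
open import Relation.Nullary using (¬_)
open import Relation.Binary.PropositionalEquality using (_≡_)

-- Finite binary sequences; 2^q = lists of length q.
Seq : Set
Seq = List Bool

tri : ℕ → ℕ
tri zero = zero
tri (suc n) = suc n + tri n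

-- ⟨n,p⟩ = (Σ_{k ≤ n+p} k) + p  (= φ⁻¹(n,p))
pair : ℕ → ℕ → ℕ
pair n p = tri (n + p) + p

-- (q)₀ ≡ m, i.e. φ(q) = (m , p) for some p
First≡ : ℕ → ℕ → Set
First≡ q m = ∃ λ p → pair m p ≡ q

CondA : (Seq → Seq → Set) → Set
CondA E = (q : ℕ) → Σ (Seq × Seq) λ st →
  (length (proj₁ st) ≡ q × length (proj₂ st) ≡ q × E (proj₁ st) (proj₂ st))
  × ((s' t' : Seq) → length s' ≡ q → length t' ≡ q → E s' t' →
       (s' ≡ proj₁ st × t' ≡ proj₂ st))

sₜ : {E : Seq → Seq → Set} → CondA E → ℕ → Seq
sₜ a q = proj₁ (proj₁ (a q))

tₜ : {E : Seq → Seq → Set} → CondA E → ℕ → Seq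
tₜ a q = proj₂ (proj₁ (a q))

CondB : (E : Seq → Seq → Set) → CondA E → Set
CondB E a = (m p : ℕ) (u : Seq) → ∃ λ v →
  E (sₜ a p ++ false ∷ u ++ v) (tₜ a p ++ true ∷ u ++ v)
  × First≡ (length (tₜ a p ++ true ∷ u ++ v) ∸ 1) m

CondC : (E : Seq → Seq → Set) → CondA E → Set
CondC E a = (n : ℕ) → 0 < n → ∃ λ q → q < n × ∃ λ w →
  (sₜ a n ≡ sₜ a q ++ false ∷ w × tₜ a n ≡ tₜ a q ++ true ∷ w)

IsTest : (Seq → Seq → Set) → Set
IsTest E = ((s t : Seq) → E s t → length s ≡ length t)
  × Σ (CondA E) λ a → CondB E a × CondC E a

GenTree : (E : Seq → Seq → Set) → CondA E → Seq → Seq → Set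
GenTree E a s t = (s ≡ [] × t ≡ [])
  ⊎ ∃ λ q → ∃ λ w → (s ≡ sₜ a q ++ false ∷ w × t ≡ tₜ a q ++ true ∷ w)

IsTree2x2 : (Seq → Seq → Set) → Set
IsTree2x2 T = ((s t : Seq) → T s t → length s ≡ length t)
  × ((s t : Seq) → T s t → (k : ℕ) → k ≤ length s → T (take k s) (take k t))

-- Vertices of the level graph: (sequence , side), side false = 0, true = 1.
Vertex : Set
Vertex = Seq × Bool

Adj : (Seq → Seq → Set) → ℕ → Vertex → Vertex → Set
Adj T p (s , false) (t , false) = ⊥
Adj T p (s , false) (t , true)  = length s ≡ p × length t ≡ p × T s t
Adj T p (s , true)  (t , false) = length s ≡ p × length t ≡ p × T t s
Adj T p (s , true)  (t , true)  = ⊥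

Closes : (Vertex → Vertex → Set) → List Vertex → Set
Closes R vs with head vs | last vs
... | just x | just y = R y x
... | _ | _ = ⊥

IsCycle : (Seq → Seq → Set) → ℕ → List Vertex → Set
IsCycle T p vs = 3 ≤ length vs × Unique vs
  × All (λ v → length (proj₁ v) ≡ p) vs
  × Linked (Adj T p) vs × Closes (Adj T p) vs

AcyclicLevels : (Seq → Seq → Set) → Set
AcyclicLevels T = (p : ℕ) (vs : List Vertex) → ¬ IsCycle T p vs

-- Every node of T is the root or (s_q 0 w , t_q 1 w).  Restricting the
-- latter to k letters either still lies beyond the branching point (giving
-- (s_q 0 w' , t_q 1 w')) or cuts inside the stem (s_q , t_q).  By condition (c)
-- a stem (s_q , t_q), q > 0, is itself a node (s_r 0 w , t_r 1 w) with r < q,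
-- so strong induction on q shows that T is closed under restriction.
--
-- Acyclic levels, by induction on the level.  Colour a vertex by the last
-- letter of its label.  The only edge of level p + 1 joining vertices of
-- different colours is the new branching edge A = (s_p 0) — B = (t_p 1); every
-- other edge is (x b , y b) with (x , y) an edge of level p.  A general graph
-- lemma shows that a cycle in a graph whose only colour-changing edge is A — B
-- is monochromatic (it could cross that edge only once, but must come back).
-- Deleting the common last letter of a monochromatic cycle of level p + 1
-- yields a cycle of level p; level 0 has only two vertices, hence no cycle.
module Submission where

open import Defs
open import Data.Bool using (Bool; true; false)
import Data.Bool.Properties as Bool
open import Data.Empty using (⊥; ⊥-elim)
open import Data.List using (List; []; _∷_; _++_; _∷ʳ_; [_]; length; take; map; last; initLast; _∷ʳ′_)
open import Data.List.Properties
  using (length-++; ++-assoc; ++-identityʳ; take-all; take-[]; map-++; ∷ʳ-++; ∷ʳ-injective)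
import Data.List.Properties as List
open import Data.List.Membership.Propositional using (_∈_)
open import Data.List.Membership.Propositional.Properties using (∈-∃++; ∈-++⁺ʳ)
import Data.List.Relation.Binary.Permutation.Setoid.Properties as PermutationProperties
import Data.List.Relation.Binary.Permutation.Setoid as Permutation
open import Data.List.Relation.Unary.All as All using (All; []; _∷_)
open import Data.List.Relation.Unary.All.Properties using (¬Any⇒All¬; ++⁺; ++⁻ˡ)
open import Data.List.Relation.Unary.Any using (here; there)
open import Data.List.Relation.Unary.Linked as Linked using (Linked; [-]; _∷_)
open import Data.List.Relation.Unary.Linked.Properties using (Linked⇒All)
import Data.List.Relation.Unary.Linked.Properties as LinkedProperties
open import Data.List.Relation.Unary.AllPairs using (_∷_)
open import Data.List.Relation.Unary.Unique.Propositional using (Unique)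
import Data.List.Relation.Unary.Unique.Propositional.Properties as UniqueProperties
open import Data.Maybe using (just; nothing; fromMaybe)
open import Data.Maybe.Relation.Binary.Connected using (Connected; just; nothing-just)
open import Data.Nat using (ℕ; zero; suc; _+_; _∸_; _<_; _≤_; z≤n; s≤s)
open import Data.Nat.Induction using (<-rec)
open import Data.Nat.Properties using (+-comm; suc-injective; m∸n≢0⇒n<m; <⇒≤; 0≢1+n)
open import Data.Product using (∃; ∃₂; _×_; _,_; proj₁; proj₂; map₁; map₂; uncurry)
import Data.Product.Properties as Product
open import Data.Sum using (_⊎_; inj₁; inj₂)
open import Function using (_on_)
open import Relation.Binary.Definitions using (DecidableEquality)
open import Relation.Binary.PropositionalEquality hiding ([_])
open import Relation.Nullary using (¬_; yes; no)

module _ {X : Set} where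

  last-∷ʳ : ∀ (xs : List X) b → last (xs ∷ʳ b) ≡ just b
  last-∷ʳ []           b = refl
  last-∷ʳ (x ∷ [])     b = refl
  last-∷ʳ (x ∷ y ∷ xs) b = last-∷ʳ (y ∷ xs) b

  ∷ʳ-level : ∀ {p} (xs : List X) b → length (xs ∷ʳ b) ≡ suc p → length xs ≡ p
  ∷ʳ-level xs b level = suc-injective (trans (+-comm 1 (length xs)) (trans (sym (length-++ xs)) level))

  take-++ : ∀ k (l r : List X) → take k (l ++ r) ≡ take k l ++ take (k ∸ length l) r
  take-++ zero    []      r = refl
  take-++ zero    (x ∷ l) r = refl
  take-++ (suc k) []      r = refl
  take-++ (suc k) (x ∷ l) r = cong (x ∷_) (take-++ k l r)

module Walks {V : Set} {R : V → V → Set} where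

  Linked-split : ∀ xs {y ys} → Linked R (xs ++ y ∷ ys) →
    Linked R (xs ∷ʳ y) × Linked R (y ∷ ys)
  Linked-split []                 walk         = [-] , walk
  Linked-split (x ∷ [])           (r ∷ walk)   = r ∷ [-] , walk
  Linked-split (x ∷ x′ ∷ xs)      (r ∷ walk)   = map₁ (r ∷_) (Linked-split (x′ ∷ xs) walk)

  Linked-glue : ∀ xs {y ys} → Linked R (xs ∷ʳ y) → Linked R (y ∷ ys) →
    Linked R (xs ++ y ∷ ys)
  Linked-glue []            _            walk = walk
  Linked-glue (x ∷ [])      (r ∷ [-])    walk = r ∷ walk
  Linked-glue (x ∷ x′ ∷ xs) (r ∷ walk₁)  walk = r ∷ Linked-glue (x′ ∷ xs) walk₁ walk

  Linked-last : ∀ xs {y z} → Linked R (xs ∷ʳ y ∷ʳ z) → Linked R (xs ∷ʳ y) × R y z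
  Linked-last xs walk =
    map₂ Linked.head (Linked-split xs (subst (Linked R) (∷ʳ-++ xs _ _) walk))

  Linked-restrict : ∀ {P : V → Set} {S : V → V → Set} →
    (∀ {u v} → P u → P v → R u v → S u v) →
    ∀ {xs} → All P xs → Linked R xs → Linked S xs
  Linked-restrict f _              Linked.[]  = Linked.[]
  Linked-restrict f _              [-]        = [-]
  Linked-restrict f (pu ∷ pv ∷ ps) (r ∷ walk) = f pu pv r ∷ Linked-restrict f (pv ∷ ps) walk

  ClosedWalk : V → List V → Set
  ClosedWalk x xs = Linked R (x ∷ xs ∷ʳ x)

  rotate : ∀ ys {x a zs} → ClosedWalk x (ys ++ a ∷ zs) → ClosedWalk a (zs ++ x ∷ ys)
  rotate ys {x} {a} {zs} walk =
    subst (Linked R) (cong (a ∷_) (sym (++-assoc zs (x ∷ ys) [ a ])))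
      (Linked-glue (a ∷ zs) toX fromX)
    where
    halves : Linked R (x ∷ ys ∷ʳ a) × Linked R (a ∷ zs ∷ʳ x)
    halves = Linked-split (x ∷ ys)
      (subst (Linked R) (cong (x ∷_) (++-assoc ys (a ∷ zs) [ x ])) walk)
    fromX = proj₁ halves
    toX   = proj₂ halves

  ClosedWalk-map⁻ : ∀ {W : Set} (g : W → V) x xs →
    ClosedWalk (g x) (map g xs) → Linked (R on g) (x ∷ xs ∷ʳ x)
  ClosedWalk-map⁻ g x xs walk =
    LinkedProperties.map⁻ (subst (Linked R) (cong (g x ∷_) (sym (map-++ g xs [ x ]))) walk)

module Colouring {V C : Set} (_≟ⱽ_ : DecidableEquality V) (_≟ᶜ_ : DecidableEquality C)
  (R : V → V → Set) (colour : V → C) (A B : V)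
  (bridge : ∀ {u v} → R u v → colour u ≢ colour v → (u ≡ A × v ≡ B) ⊎ (u ≡ B × v ≡ A))
  where

  open Walks {R = R}
  open import Data.List.Membership.DecPropositional _≟ⱽ_ using (_∈?_)
  open Permutation (setoid V) using (_↭_; ↭-sym)
  open PermutationProperties (setoid V) using (Unique-resp-↭; All-resp-↭; ++-comm; xs↭ys⇒|xs|≡|ys|)

  Monochromatic : List V → Set
  Monochromatic vs = ∃ λ c → All (λ v → colour v ≡ c) vs

  away-from-A : ∀ {u v} → A ≢ u → A ≢ v → R u v → colour u ≡ colour v
  away-from-A {u} {v} A≢u A≢v r with colour u ≟ᶜ colour v
  ... | yes same = same
  ... | no differ with bridge r differ
  ... | inj₁ (u≡A , _) = ⊥-elim (A≢u (sym u≡A))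
  ... | inj₂ (_ , v≡A) = ⊥-elim (A≢v (sym v≡A))

  avoiding-A : ∀ {x xs} → All (A ≢_) (x ∷ xs) → Linked R (x ∷ xs) →
    All (λ v → colour v ≡ colour x) (x ∷ xs)
  avoiding-A avoids walk =
    All.map sym (Linked⇒All trans refl (Linked-restrict away-from-A avoids walk))

  leaving-A : ∀ {v} → A ≢ v → R A v → colour A ≢ colour v → v ≡ B
  leaving-A A≢v r differ with bridge r differ
  ... | inj₁ (_ , v≡B)  = v≡B
  ... | inj₂ (_ , v≡A)  = ⊥-elim (A≢v (sym v≡A))

  entering-A : ∀ {v} → A ≢ v → R v A → colour v ≢ colour A → v ≡ B
  entering-A A≢v r differ with bridge r differ
  ... | inj₁ (v≡A , _)  = ⊥-elim (A≢v (sym v≡A))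
  ... | inj₂ (v≡B , _)  = v≡B

  -- A cycle through A: the rest r ∷ … ∷ l of the cycle avoids A, so it is
  -- monochromatic.  If its colour differed from that of A, both r and l would be B.
  cycle-from-A : ∀ r mid l → Unique (A ∷ r ∷ mid ∷ʳ l) →
    Linked R (A ∷ r ∷ mid ∷ʳ l) → R l A → Monochromatic (A ∷ r ∷ mid ∷ʳ l)
  cycle-from-A r mid l (A∉rest ∷ r∉rest ∷ _) walk l→A
    with colour A ≟ᶜ colour r | avoiding-A A∉rest (Linked.tail walk)
  ... | yes same   | rest-colour = colour r , same ∷ rest-colour
  ... | no  differ | rest-colour = ⊥-elim (All.lookup r∉rest l∈rest (trans r≡B (sym l≡B)))
    where
    l∈rest : l ∈ mid ∷ʳ l
    l∈rest = ∈-++⁺ʳ mid (here refl)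
    r≡B : r ≡ B
    r≡B = leaving-A (All.lookup A∉rest (here refl)) (Linked.head walk) differ
    l≡B : l ≡ B
    l≡B = entering-A (All.lookup A∉rest (there l∈rest)) l→A
            (λ same → differ (trans (sym same) (All.lookup rest-colour (there l∈rest))))

  cycle-through-A : ∀ rs → 3 ≤ length (A ∷ rs) → Unique (A ∷ rs) → ClosedWalk A rs →
    Monochromatic (A ∷ rs)
  cycle-through-A []         (s≤s ()) _ _
  cycle-through-A (r ∷ rest) long unique walk with initLast rest
  cycle-through-A (r ∷ .[]) (s≤s (s≤s ())) _ _ | []
  ... | mid ∷ʳ′ l = uncurry (cycle-from-A r mid l unique) (Linked-last (A ∷ r ∷ mid) walk)

  -- Cycles are monochromatic: either A is not on the cycle, or the cycle may
  -- be rotated to start at A.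
  monochromatic : ∀ x xs → 3 ≤ length (x ∷ xs) → Unique (x ∷ xs) → ClosedWalk x xs →
    Monochromatic (x ∷ xs)
  monochromatic x xs long unique walk with A ∈? (x ∷ xs)
  ... | no A∉cycle = colour x , ++⁻ˡ (x ∷ xs) (avoiding-A (++⁺ avoids (All.head avoids ∷ [])) walk)
    where
    avoids : All (A ≢_) (x ∷ xs)
    avoids = ¬Any⇒All¬ (x ∷ xs) A∉cycle
  ... | yes A∈cycle with ∈-∃++ A∈cycle
  ...   | []     , zs , refl = cycle-through-A zs long unique walk
  ...   | _ ∷ ys , zs , refl = map₂ (All-resp-↭ (λ { refl same → same }) (↭-sym rotation))
           (cycle-through-A (zs ++ x ∷ ys) (subst (3 ≤_) (xs↭ys⇒|xs|≡|ys| rotation) long)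
              (Unique-resp-↭ rotation unique) (rotate ys walk))
    where
    rotation : (x ∷ ys) ++ (A ∷ zs) ↭ (A ∷ zs) ++ (x ∷ ys)
    rotation = ++-comm (x ∷ ys) (A ∷ zs)

cycle-closes : ∀ {R : Vertex → Vertex → Set} x xs → Closes R (x ∷ xs) →
  Connected R (last (x ∷ xs)) (just x)
cycle-closes x xs closes with last (x ∷ xs)
... | just _  = just closes
... | nothing = nothing-just

cycle⇒closedWalk : ∀ {R : Vertex → Vertex → Set} x xs → Linked R (x ∷ xs) →
  Closes R (x ∷ xs) → Walks.ClosedWalk {R = R} x xs
cycle⇒closedWalk x xs walk closes = LinkedProperties.++⁺ walk (cycle-closes x xs closes) [-]

_≟ⱽ_ : DecidableEquality Vertex
_≟ⱽ_ = Product.≡-dec (List.≡-dec Bool._≟_) Bool._≟_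

AtLevel : ℕ → Vertex → Set
AtLevel p v = length (proj₁ v) ≡ p

colour : Vertex → Bool
colour (x , _) = fromMaybe false (last x)

extend : Bool → Vertex → Vertex
extend b (x , side) = (x ∷ʳ b , side)

colour-extend : ∀ b v → colour (extend b v) ≡ b
colour-extend b (x , _) = cong (fromMaybe false) (last-∷ʳ x b)

lower : ∀ {p} v → AtLevel (suc p) v → ∃₂ λ b w → AtLevel p w × v ≡ extend b w
lower (x , side) level with initLast x
lower (.[] , side)        ()    | []
lower (.(x ∷ʳ b) , side)  level | x ∷ʳ′ b = b , (x , side) , ∷ʳ-level x b level , refl

lower-all : ∀ {p b} vs → All (AtLevel (suc p)) vs → All (λ v → colour v ≡ b) vs →
  ∃ λ ws → All (AtLevel p) ws × vs ≡ map (extend b) ws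
lower-all [] [] [] = [] , [] , refl
lower-all (v ∷ vs) (level ∷ levels) (coloured ∷ colours)
  with lower v level | lower-all vs levels colours
... | b′ , w , level′ , refl | ws , levels′ , refl
  with trans (sym (colour-extend b′ w)) coloured
... | refl = w ∷ ws , level′ ∷ levels′ , refl

pigeonhole : ∀ (a b c : Bool) → a ≡ b ⊎ a ≡ c ⊎ b ≡ c
pigeonhole false false _     = inj₁ refl
pigeonhole true  true  _     = inj₁ refl
pigeonhole false true  false = inj₂ (inj₁ refl)
pigeonhole false true  true  = inj₂ (inj₂ refl)
pigeonhole true  false false = inj₂ (inj₂ refl)
pigeonhole true  false true  = inj₂ (inj₁ refl)

-- Level 0 has only the two vertices ([] , false) and ([] , true), so it has
-- no three distinct vertices.
no-three-at-level-zero : ∀ vs → 3 ≤ length vs → All (AtLevel 0) vs → ¬ Unique vs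
no-three-at-level-zero (([] , a) ∷ ([] , b) ∷ ([] , c) ∷ _) _ _
  ((a≢b ∷ a≢c ∷ _) ∷ (b≢c ∷ _) ∷ _) with pigeonhole a b c
... | inj₁ refl        = a≢b refl
... | inj₂ (inj₁ refl) = a≢c refl
... | inj₂ (inj₂ refl) = b≢c refl
no-three-at-level-zero ((_ ∷ _ , _) ∷ _)                     _ (() ∷ _)
no-three-at-level-zero (_ ∷ (_ ∷ _ , _) ∷ _)                 _ (_ ∷ () ∷ _)
no-three-at-level-zero (_ ∷ _ ∷ (_ ∷ _ , _) ∷ _)             _ (_ ∷ _ ∷ () ∷ _)
no-three-at-level-zero []                  ()
no-three-at-level-zero (_ ∷ [])            (s≤s ())
no-three-at-level-zero (_ ∷ _ ∷ [])        (s≤s (s≤s ()))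

module GeneratedTree (E : Seq → Seq → Set) (a : CondA E) where

  s t : ℕ → Seq
  s = sₜ a
  t = tₜ a

  T : Seq → Seq → Set
  T = GenTree E a

  length-s : ∀ q → length (s q) ≡ q
  length-s q = proj₁ (proj₁ (proj₂ (a q)))

  length-t : ∀ q → length (t q) ≡ q
  length-t q = proj₁ (proj₂ (proj₁ (proj₂ (a q))))

  T-length : ∀ x y → T x y → length x ≡ length y
  T-length _ _ (inj₁ (refl , refl)) = refl
  T-length _ _ (inj₂ (q , w , refl , refl)) = begin
    length (s q ++ false ∷ w)      ≡⟨ length-++ (s q) ⟩
    length (s q) + suc (length w)  ≡⟨ cong (_+ suc (length w)) (trans (length-s q) (sym (length-t q))) ⟩
    length (t q) + suc (length w)  ≡⟨ length-++ (t q) ⟨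
    length (t q ++ true ∷ w)       ∎
    where open ≡-Reasoning

  module Restriction (c : CondC E a) where

    StemRestricts : ℕ → Set
    StemRestricts q = ∀ k → T (take k (s q)) (take k (t q))

    take-node : ∀ {q} (l : Seq) k b w → length l ≡ q → take k (l ++ b ∷ w) ≡ take k l ++ take (k ∸ q) (b ∷ w)
    take-node l k b w level = trans (take-++ k l (b ∷ w)) (cong (λ n → take k l ++ take (k ∸ n) (b ∷ w)) level)

    -- If the stem of q is closed under restriction, so is every node (s_q 0 w , t_q 1 w):
    -- a restriction either cuts the stem or is again such a node.
    node-restricts : ∀ q → StemRestricts q → ∀ w k → T (take k (s q ++ false ∷ w)) (take k (t q ++ true ∷ w))
    node-restricts q stem w k =
      subst₂ T (sym (take-node (s q) k false w (length-s q))) (sym (take-node (t q) k true w (length-t q)))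
        (overhang (k ∸ q) refl)
      where
      overhang : ∀ d → k ∸ q ≡ d → T (take k (s q) ++ take d (false ∷ w)) (take k (t q) ++ take d (true ∷ w))
      overhang zero    _        = subst₂ T (sym (++-identityʳ _)) (sym (++-identityʳ _)) (stem k)
      overhang (suc j) k∸q≡1+j  = inj₂ (q , take j w , cong (_++ false ∷ take j w) (whole (s q) (length-s q))
                                                      , cong (_++ true ∷ take j w) (whole (t q) (length-t q)))
        where
        q≤k : q ≤ k
        q≤k = <⇒≤ (m∸n≢0⇒n<m (λ k∸q≡0 → 0≢1+n (trans (sym k∸q≡0) k∸q≡1+j)))
        whole : ∀ l → length l ≡ q → take k l ≡ l
        whole l level = take-all k l (subst (_≤ k) (sym level) q≤k)

    stem-restricts : ∀ q → StemRestricts q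
    stem-restricts = <-rec StemRestricts step
      where
      length-zero : ∀ {l : Seq} → length l ≡ 0 → l ≡ []
      length-zero {[]} _ = refl
      step : ∀ q → (∀ {r} → r < q → StemRestricts r) → StemRestricts q
      step zero _ k = subst₂ T (sym (restrict-empty (length-s 0))) (sym (restrict-empty (length-t 0)))
                        (inj₁ (refl , refl))
        where restrict-empty : ∀ {l} → length l ≡ 0 → take k l ≡ []
              restrict-empty level = trans (cong (take k) (length-zero level)) (take-[] k)
      step (suc q) below k with c (suc q) (s≤s z≤n)
      ... | r , r<q , w , s≡ , t≡ =
        subst₂ T (cong (take k) (sym s≡)) (cong (take k) (sym t≡)) (node-restricts r (below r<q) w k)

    T-restrict : ∀ x y → T x y → ∀ k → k ≤ length x → T (take k x) (take k y)
    T-restrict _ _ (inj₁ (refl , refl))         k _ = inj₁ (take-[] k , take-[] k)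
    T-restrict _ _ (inj₂ (q , w , refl , refl)) k _ = node-restricts q (stem-restricts q) w k

  T-snoc : ∀ x y {b b′} → T (x ∷ʳ b) (y ∷ʳ b′) →
    (b ≡ b′ × T x y) ⊎ (b ≡ false × b′ ≡ true × ∃ λ q → x ≡ s q × y ≡ t q)
  T-snoc []      _ (inj₁ (() , _))
  T-snoc (_ ∷ _) _ (inj₁ (() , _))
  T-snoc x y (inj₂ (q , w , x≡ , y≡)) with initLast w
  ... | [] with ∷ʳ-injective x (s q) x≡ | ∷ʳ-injective y (t q) y≡
  ...   | x≡s , b≡false | y≡t , b′≡true = inj₂ (b≡false , b′≡true , q , x≡s , y≡t)
  T-snoc x y (inj₂ (q , .(w ∷ʳ d) , x≡ , y≡)) | w ∷ʳ′ d
    with ∷ʳ-injective x (s q ++ false ∷ w) (trans x≡ (sym (++-assoc (s q) (false ∷ w) [ d ])))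
       | ∷ʳ-injective y (t q ++ true ∷ w) (trans y≡ (sym (++-assoc (t q) (true ∷ w) [ d ])))
  ... | x≡′ , b≡d | y≡′ , b′≡d = inj₁ (trans b≡d (sym b′≡d) , inj₂ (q , w , x≡′ , y≡′))

  T-descend : ∀ x y {b} → T (x ∷ʳ b) (y ∷ʳ b) → T x y
  T-descend x y τ with T-snoc x y τ
  ... | inj₁ (_ , τ′)         = τ′
  ... | inj₂ (refl , () , _)

  A B : ℕ → Vertex
  A p = (s p ∷ʳ false , false)
  B p = (t p ∷ʳ true , true)

  Adj-level : ∀ {p} u v → Adj T p u v → AtLevel p u × AtLevel p v
  Adj-level (_ , false) (_ , false) ()
  Adj-level (_ , false) (_ , true)  (level₁ , level₂ , _) = level₁ , level₂
  Adj-level (_ , true)  (_ , false) (level₁ , level₂ , _) = level₁ , level₂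
  Adj-level (_ , true)  (_ , true)  ()

  Adj-descend : ∀ {p b} u v → Adj T (suc p) (extend b u) (extend b v) → Adj T p u v
  Adj-descend (_ , false) (_ , false) ()
  Adj-descend (x , false) (y , true)  (level₁ , level₂ , τ) =
    ∷ʳ-level x _ level₁ , ∷ʳ-level y _ level₂ , T-descend x y τ
  Adj-descend (x , true)  (y , false) (level₁ , level₂ , τ) =
    ∷ʳ-level x _ level₁ , ∷ʳ-level y _ level₂ , T-descend y x τ
  Adj-descend (_ , true)  (_ , true)  ()

  branch-level : ∀ {p} q → length (s q ∷ʳ false) ≡ suc p → q ≡ p
  branch-level q level = trans (sym (length-s q)) (∷ʳ-level (s q) false level)

  extended-bridge : ∀ {p b b′} u v → Adj T (suc p) (extend b u) (extend b′ v) → b ≢ b′ →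
    (extend b u ≡ A p × extend b′ v ≡ B p) ⊎ (extend b u ≡ B p × extend b′ v ≡ A p)
  extended-bridge (_ , false) (_ , false) ()
  extended-bridge (x , false) (y , true)  (level , _ , τ) differ with T-snoc x y τ
  ... | inj₁ (same , _) = ⊥-elim (differ same)
  ... | inj₂ (refl , refl , q , refl , refl) with branch-level q level
  ...   | refl = inj₁ (refl , refl)
  extended-bridge (x , true)  (y , false) (_ , level , τ) differ with T-snoc y x τ
  ... | inj₁ (same , _) = ⊥-elim (differ (sym same))
  ... | inj₂ (refl , refl , q , refl , refl) with branch-level q level
  ...   | refl = inj₂ (refl , refl)
  extended-bridge (_ , true)  (_ , true)  ()

  Adj-bridge : ∀ p {u v} → Adj T (suc p) u v → colour u ≢ colour v →
    (u ≡ A p × v ≡ B p) ⊎ (u ≡ B p × v ≡ A p)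
  Adj-bridge p {u} {v} adj differ
    with lower u (proj₁ (Adj-level u v adj)) | lower v (proj₂ (Adj-level u v adj))
  ... | b , u′ , _ , refl | b′ , v′ , _ , refl =
    extended-bridge u′ v′ adj
      (λ same → differ (trans (colour-extend b u′) (trans same (sym (colour-extend b′ v′)))))

  module LevelColouring (p : ℕ) =
    Colouring _≟ⱽ_ Bool._≟_ (Adj T (suc p)) colour (A p) (B p) (Adj-bridge p)

  -- No level contains a cycle: a cycle of level p + 1 is monochromatic, and
  -- removing its common last letter gives a cycle of level p.
  no-cycle : ∀ p x xs → 3 ≤ length (x ∷ xs) → Unique (x ∷ xs) → All (AtLevel p) (x ∷ xs) →
    Walks.ClosedWalk {R = Adj T p} x xs → ⊥
  no-cycle zero x xs long unique levels _ = no-three-at-level-zero (x ∷ xs) long levels unique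
  no-cycle (suc p) x xs long unique levels walk
    with LevelColouring.monochromatic p x xs long unique walk
  ... | b , colours with lower-all (x ∷ xs) levels colours
  ...   | w ∷ ws , levels′ , refl =
    no-cycle p w ws (subst (3 ≤_) (List.length-map (extend b) (w ∷ ws)) long)
      (UniqueProperties.map⁻ unique) levels′
      (Linked.map (Adj-descend _ _) (Walks.ClosedWalk-map⁻ (extend b) w ws walk))

  acyclic : AcyclicLevels T
  acyclic p []       (() , _)
  acyclic p (x ∷ xs) (long , unique , levels , walk , closes) =
    no-cycle p x xs long unique levels (cycle⇒closedWalk x xs walk closes)

proposition3p2 : (E : Seq → Seq → Set) (test : IsTest E) →
    IsTree2x2 (GenTree E (proj₁ (proj₂ test)))
    × AcyclicLevels (GenTree E (proj₁ (proj₂ test)))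
proposition3p2 E (_ , a , _ , c) = (T-length , T-restrict) , acyclic
  where
  open GeneratedTree E a
  open Restriction c
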